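{- Let $G$ be an abelian group and $\alpha,\beta\in G$. Let $X,Y$ be finite multisets of finite nonempty sequences over $G$ such that $f^{r}_{\gamma}(X)=f^{r}_{\gamma}(Y)$ for every integer $r\ge 0$ and every $\gamma\in G$. Then for every $r\ge 0$ and $\gamma\in G$: (a) $f^{r}_{\gamma}(M(X))=f^{r}_{\gamma}(M(Y))$; (b) $f^{r}_{\gamma}(R_{\alpha,\beta}(X))=f^{r}_{\gamma}(R_{\alpha,\beta}(Y))$; (c) $f^{r}_{\gamma}(R_{\alpha,\beta}(X))=f^{r}_{\gamma}(R_{\beta,\alpha}(Y))$.
   Context: $G^*$ denotes the set of finite nonempty sequences over $G$. For $u=x_1\dots x_k$ and $y\in G$, $x_1\dots x_k+y$ denotes $(x_1+y)\dots(x_k+y)$. For $r\ge0$ and $\gamma\in G$, $f^{r}_{\gamma}(x_1\dots x_l)$ is the multiset $\{x_{a_1}+\dots+x_{a_r}-(r-1)x_1+\gamma : 1<a_1<\dots<a_r\le l\}$ (so $f^0_0(x_1\dots x_l)=\{x_1\}$, $f^1_0(x_1\dots x_l)=\{x_2,\dots,x_l\}$). $M(x_1\dots x_l)=x_1x_1x_2\dots x_l$. For $1\le i\le l$, $R_{\alpha,\beta,i}(x_1\dots x_l)=x_i\,(x_1\dots x_{i-1}+(x_i-x_1+\alpha))\,(x_{i+1}\dots x_l+(x_i-x_1+\beta))$, and $R_{\alpha,\beta}(x_1\dots x_l)$ is the multiset $\{R_{\alpha,\beta,i}(x_1\dots x_l):1\le i\le l\}$. Any map from sequences to elements or multisets is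 extended to multisets of sequences by taking the multiset union (adding multiplicities) of the images of the elements. -}

module Defs where

open import Level using (Level)
open import Data.Nat using (ℕ; zero; suc)
open import Data.Product using (_×_; _,_)
open import Data.List using (List; []; _∷_; map; _++_; concatMap; foldr)
open import Data.List.NonEmpty using (List⁺; _∷_; toList)
open import Algebra.Bundles using (AbelianGroup)
import Data.List.Relation.Binary.Permutation.Setoid as PermS

-- Sub-sequences of length r of a list (order preserved), counted with
-- multiplicity by index sets: choose r xs = all x_{a_1}..x_{a_r}, a_1<..<a_r.
choose : ∀ {a} {A : Set a} → ℕ → List A → List (List A)
choose zero    xs       = [] ∷ []
choose (suc r) []       = []
choose (suc r) (x ∷ xs) = map (x ∷_) (choose r xs) ++ choose (suc r) xs

picks : ∀ {a} {A : Set a} → List A → List (List A × A × List A)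
picks []       = []
picks (x ∷ xs) = ([] , x , xs) ∷ map (λ { (p , y , q) → (x ∷ p , y , q) }) (picks xs)

module _ {c ℓ : Level} (G : AbelianGroup c ℓ) where
  open AbelianGroup G renaming (Carrier to A)

  sumG : List A → A
  sumG = foldr _∙_ ε

  times : ℕ → A → A
  times zero    x = ε
  times (suc n) x = x ∙ times n x

  _-ᴳ_ : A → A → A
  x -ᴳ y = x ∙ (y ⁻¹)

  -- Multiset equality of multisets of group elements (lists up to
  -- permutation, elements compared with the group's equality).
  _≋_ : List A → List A → Set (c Level.⊔ ℓ)
  _≋_ = PermS._↭_ setoid

  -- f^r_γ on one sequence x_1 … x_l :
  --   { x_{a_1}+…+x_{a_r} - (r-1) x_1 + γ : 1 < a_1 < … < a_r ≤ l }
  -- where -(r-1)x_1 is written as x_1 - r·x_1 (valid also for r = 0).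
  f₁ : ℕ → A → List⁺ A → List A
  f₁ r γ (x ∷ xs) = map (λ s → ((sumG s ∙ x) -ᴳ times r x) ∙ γ) (choose r xs)

  f : ℕ → A → List (List⁺ A) → List A
  f r γ X = concatMap (f₁ r γ) X

  M₁ : List⁺ A → List⁺ A
  M₁ (x ∷ xs) = x ∷ (x ∷ xs)

  M : List (List⁺ A) → List (List⁺ A)
  M = map M₁

  shift : A → List A → List A
  shift y = map (_∙ y)

  R₁ : A → A → List⁺ A → List (List⁺ A)
  R₁ α β (x ∷ xs) =
    map (λ { (p , y , q) →
             y ∷ (shift ((y -ᴳ x) ∙ α) p ++ shift ((y -ᴳ x) ∙ β) q) })
        (picks (x ∷ xs))

  R : A → A → List (List⁺ A) → List (List⁺ A)
  R α β X = concatMap (R₁ α β) X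

-- For a single sequence w, the multisets f^r_γ(M w) and f^r_γ(R_{α,β} w) are finite
-- unions of multisets f^{r'}_{γ'}(w), with (r', γ') depending only on r, γ, α, β:
--   f^{r+1}_γ(M w) = f^r_γ(w) ⊎ f^{r+1}_γ(w),
--   f^r_γ(R_{α,β} w) = ⊎_{m+n=r} f^r_{γ+mα+nβ}(w) ⊎ f^{r+1}_{γ+mα+nβ}(w).
-- For the second, an r-subsequence of R_{α,β,i}(w) splits into m terms taken before and
-- n terms taken after the pivot x_i (Vandermonde); together with x_i they form an
-- (r+1)-subsequence of w, which contributes to f^r if it contains x_1 and to f^{r+1}
-- otherwise. Both identities are additive in the sequence, so f(X) = f(Y) transfers to
-- M and R; (c) holds because the splits (m, n) of r are symmetric.

module Submission where

open import Defs
open import Level using (Level)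
open import Function using (_∘_)
open import Data.Nat using (ℕ; zero; suc; _+_)
open import Data.Product using (_×_; _,_; swap; map₁; map₂)
open import Data.List using (List; []; _∷_; map; _++_; concatMap; _∷ʳ_; length)
open import Data.List.NonEmpty using (List⁺; _∷_)
open import Data.List.Properties
  using (concatMap-++; concatMap-map; concatMap-cong; map-concatMap; map-++; map-∘; map-id; ++-assoc; ++-identityʳ)
open import Data.List.Relation.Unary.All as All using (All; []; _∷_)
open import Data.List.Relation.Unary.All.Properties using () renaming (map⁺ to All-map⁺; ++⁺ to All-++⁺)
open import Algebra.Bundles using (AbelianGroup)
open import Relation.Binary.PropositionalEquality as ≡ using (_≡_; cong; cong₂)
import Data.List.Relation.Binary.Permutation.Propositional as Propositional
import Data.List.Relation.Binary.Permutation.Propositional.Properties as PropositionalProperties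
import Data.List.Relation.Binary.Permutation.Setoid as Permutation
import Data.List.Relation.Binary.Permutation.Setoid.Properties as PermutationProperties
import Relation.Binary.Reasoning.Setoid as ≈-Reasoning

module Combinatorics where

  open Propositional hiding (swap)
  open PropositionalProperties using (map⁺; ++⁺ˡ; ++⁺; shifts; ∷↭∷ʳ)

  private variable a b c : Level

  module _ {A : Set a} {B : Set b} where

    concatMap⁺ : (f : A → List B) {xs ys : List A} → xs ↭ ys → concatMap f xs ↭ concatMap f ys
    concatMap⁺ f refl             = refl
    concatMap⁺ f (prep x p)       = ++⁺ˡ (f x) (concatMap⁺ f p)
    concatMap⁺ f (_↭_.swap x y p) = ↭-trans (++⁺ˡ (f x) (++⁺ˡ (f y) (concatMap⁺ f p))) (shifts (f x) (f y))
    concatMap⁺ f (trans p q)      = ↭-trans (concatMap⁺ f p) (concatMap⁺ f q)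

    concatMap-const-[] : (xs : List A) → concatMap {B = B} (λ _ → []) xs ≡ []
    concatMap-const-[] []       = ≡.refl
    concatMap-const-[] (x ∷ xs) = concatMap-const-[] xs

    concatMap-++-↭ : (f g : A → List B) (xs : List A) →
      concatMap (λ x → f x ++ g x) xs ↭ concatMap f xs ++ concatMap g xs
    concatMap-++-↭ f g []       = refl
    concatMap-++-↭ f g (x ∷ xs) = begin
      (f x ++ g x) ++ concatMap (λ x → f x ++ g x) xs   ≡⟨ ++-assoc (f x) (g x) _ ⟩
      f x ++ g x ++ concatMap (λ x → f x ++ g x) xs     ↭⟨ ++⁺ˡ (f x) (++⁺ˡ (g x) (concatMap-++-↭ f g xs)) ⟩
      f x ++ g x ++ concatMap f xs ++ concatMap g xs    ↭⟨ ++⁺ˡ (f x) (shifts (g x) (concatMap f xs)) ⟩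
      f x ++ concatMap f xs ++ g x ++ concatMap g xs    ≡⟨ ++-assoc (f x) _ _ ⟨
      (f x ++ concatMap f xs) ++ g x ++ concatMap g xs  ∎
      where open PermutationReasoning

  module _ {A : Set a} {B : Set b} {C : Set c} where

    concatMap-concatMap : (f : B → List C) (g : A → List B) (xs : List A) →
      concatMap f (concatMap g xs) ≡ concatMap (concatMap f ∘ g) xs
    concatMap-concatMap f g []       = ≡.refl
    concatMap-concatMap f g (x ∷ xs) =
      ≡.trans (concatMap-++ f (g x) _) (cong (concatMap f (g x) ++_) (concatMap-concatMap f g xs))

    concatMap-comm : (h : A → B → List C) (xs : List A) (ys : List B) →
      concatMap (λ x → concatMap (h x) ys) xs ↭ concatMap (λ y → concatMap (λ x → h x y) xs) ys
    concatMap-comm h []       ys = ↭-reflexive (≡.sym (concatMap-const-[] ys))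
    concatMap-comm h (x ∷ xs) ys = begin
      concatMap (h x) ys ++ concatMap (λ x → concatMap (h x) ys) xs
        ↭⟨ ++⁺ˡ (concatMap (h x) ys) (concatMap-comm h xs ys) ⟩
      concatMap (h x) ys ++ concatMap (λ y → concatMap (λ x → h x y) xs) ys
        ↭⟨ concatMap-++-↭ (h x) (λ y → concatMap (λ x → h x y) xs) ys ⟨
      concatMap (λ y → h x y ++ concatMap (λ x → h x y) xs) ys ∎
      where open PermutationReasoning

  splits : ℕ → List (ℕ × ℕ)
  splits zero    = (0 , 0) ∷ []
  splits (suc r) = (0 , suc r) ∷ map (map₁ suc) (splits r)

  splits-sum : ∀ r → All (λ (m , n) → m + n ≡ r) (splits r)
  splits-sum zero    = ≡.refl ∷ []
  splits-sum (suc r) = ≡.refl ∷ All-map⁺ (All.map (cong suc) (splits-sum r))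

  splits-suc-∷ʳ : ∀ r → splits (suc r) ≡ map (map₂ suc) (splits r) ∷ʳ (suc r , 0)
  splits-suc-∷ʳ zero    = ≡.refl
  splits-suc-∷ʳ (suc r) = cong ((0 , suc (suc r)) ∷_) (begin
    map (map₁ suc) (splits (suc r))
      ≡⟨ cong (map (map₁ suc)) (splits-suc-∷ʳ r) ⟩
    map (map₁ suc) (map (map₂ suc) (splits r) ∷ʳ (suc r , 0))
      ≡⟨ map-++ (map₁ suc) (map (map₂ suc) (splits r)) _ ⟩
    map (map₁ suc) (map (map₂ suc) (splits r)) ∷ʳ (suc (suc r) , 0)
      ≡⟨ cong (_∷ʳ (suc (suc r) , 0)) (≡.trans (≡.sym (map-∘ (splits r))) (map-∘ (splits r))) ⟩
    map (map₂ suc) (map (map₁ suc) (splits r)) ∷ʳ (suc (suc r) , 0) ∎)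
    where open ≡.≡-Reasoning

  map-swap-splits : ∀ r → map swap (splits r) ↭ splits r
  map-swap-splits zero    = refl
  map-swap-splits (suc r) = begin
    (suc r , 0) ∷ map swap (map (map₁ suc) (splits r))
      ≡⟨ cong ((suc r , 0) ∷_) (≡.trans (≡.sym (map-∘ (splits r))) (map-∘ (splits r))) ⟩
    (suc r , 0) ∷ map (map₂ suc) (map swap (splits r))  ↭⟨ prep _ (map⁺ (map₂ suc) (map-swap-splits r)) ⟩
    (suc r , 0) ∷ map (map₂ suc) (splits r)             ↭⟨ ∷↭∷ʳ _ _ ⟩
    map (map₂ suc) (splits r) ∷ʳ (suc r , 0)            ≡⟨ splits-suc-∷ʳ r ⟨
    splits (suc r)                                      ∎
    where open PermutationReasoning

  module _ {A : Set a} where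

    choose-length : ∀ m (xs : List A) → All (λ s → length s ≡ m) (choose m xs)
    choose-length zero    xs       = ≡.refl ∷ []
    choose-length (suc m) []       = []
    choose-length (suc m) (x ∷ xs) =
      All-++⁺ (All-map⁺ (All.map (cong suc) (choose-length m xs))) (choose-length (suc m) xs)

    choose₂ : {B : Set b} → (List A → List A → B) → ℕ → ℕ → List A → List A → List B
    choose₂ _⊗_ m n u v = concatMap (λ s → map (s ⊗_) (choose n v)) (choose m u)

    map-choose₂ : {B : Set b} {C : Set c} (h : B → C) (_⊗_ : List A → List A → B) → ∀ m n u v →
      map h (choose₂ _⊗_ m n u v) ≡ choose₂ (λ s t → h (s ⊗ t)) m n u v
    map-choose₂ h _⊗_ m n u v = ≡.trans (map-concatMap h _ (choose m u))
      (concatMap-cong (λ s → ≡.sym (map-∘ (choose n v))) (choose m u))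

    choose₂-suc-∷ : {B : Set b} (_⊗_ : List A → List A → B) → ∀ m n z u v →
      choose₂ _⊗_ (suc m) n (z ∷ u) v ≡ choose₂ (λ s t → (z ∷ s) ⊗ t) m n u v ++ choose₂ _⊗_ (suc m) n u v
    choose₂-suc-∷ _⊗_ m n z u v =
      ≡.trans (concatMap-++ _ (map (z ∷_) (choose m u)) _)
              (cong (_++ choose₂ _⊗_ (suc m) n u v) (concatMap-map _ (z ∷_) (choose m u)))

    choose-++ : ∀ r (u v : List A) → choose r (u ++ v) ↭ concatMap (λ (m , n) → choose₂ _++_ m n u v) (splits r)
    choose-++ zero    u       v = refl
    choose-++ (suc r) []      v = ↭-reflexive (≡.sym (begin
      (map ([] ++_) (choose (suc r) v) ++ []) ++ concatMap (λ (m , n) → choose₂ _++_ m n [] v) (map (map₁ suc) (splits r))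
        ≡⟨ cong₂ _++_ (≡.trans (++-identityʳ _) (map-id _))
                      (≡.trans (concatMap-map _ (map₁ suc) (splits r)) (concatMap-const-[] (splits r))) ⟩
      choose (suc r) v ++ []
        ≡⟨ ++-identityʳ _ ⟩
      choose (suc r) v ∎))
      where open ≡.≡-Reasoning
    choose-++ (suc r) (z ∷ u) v = begin
      map (z ∷_) (choose r (u ++ v)) ++ choose (suc r) (u ++ v)
        ↭⟨ ++⁺ (map⁺ (z ∷_) (choose-++ r u v)) (choose-++ (suc r) u v) ⟩
      map (z ∷_) C ++ C₀ ++ concatMap (λ (m , n) → choose₂ _++_ m n u v) (map (map₁ suc) (splits r))
        ≡⟨ cong (λ t → map (z ∷_) C ++ C₀ ++ t) (concatMap-map _ (map₁ suc) (splits r)) ⟩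
      map (z ∷_) C ++ C₀ ++ concatMap (λ (m , n) → choose₂ _++_ (suc m) n u v) (splits r)
        ↭⟨ shifts (map (z ∷_) C) C₀ ⟩
      C₀ ++ map (z ∷_) C ++ concatMap (λ (m , n) → choose₂ _++_ (suc m) n u v) (splits r)
        ≡⟨ cong (λ t → C₀ ++ t ++ _) (map-concatMap (z ∷_) _ (splits r)) ⟩
      C₀ ++ concatMap (λ (m , n) → map (z ∷_) (choose₂ _++_ m n u v)) (splits r)
           ++ concatMap (λ (m , n) → choose₂ _++_ (suc m) n u v) (splits r)
        ↭⟨ ++⁺ˡ C₀ (concatMap-++-↭ _ _ (splits r)) ⟨
      C₀ ++ concatMap (λ (m , n) → map (z ∷_) (choose₂ _++_ m n u v) ++ choose₂ _++_ (suc m) n u v) (splits r)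
        ≡⟨ cong (C₀ ++_) (concatMap-cong (λ (m , n) →
             ≡.trans (cong (_++ _) (map-choose₂ (z ∷_) _++_ m n u v))
                     (≡.sym (choose₂-suc-∷ _++_ m n z u v))) (splits r)) ⟩
      C₀ ++ concatMap (λ (m , n) → choose₂ _++_ (suc m) n (z ∷ u) v) (splits r)
        ≡⟨ cong (C₀ ++_) (concatMap-map _ (map₁ suc) (splits r)) ⟨
      C₀ ++ concatMap (λ (m , n) → choose₂ _++_ m n (z ∷ u) v) (map (map₁ suc) (splits r)) ∎
      where
      open PermutationReasoning
      C : List (List A)
      C = concatMap (λ (m , n) → choose₂ _++_ m n u v) (splits r)
      C₀ : List (List A)
      C₀ = choose₂ _++_ 0 (suc r) u v

    chooseAround : ℕ → ℕ → List A → List (List A)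
    chooseAround j k zs = concatMap (λ (p , y , q) → choose₂ (λ s t → s ++ y ∷ t) j k p q) (picks zs)

    choose-pivot : ∀ j k (zs : List A) → chooseAround j k zs ↭ choose (suc (j + k)) zs
    choose-pivot j       k []       = refl
    choose-pivot zero    k (z ∷ zs) = begin
      chooseAround zero k (z ∷ zs)
        ≡⟨ cong₂ _++_ (++-identityʳ _) (concatMap-map _ _ (picks zs)) ⟩
      map (z ∷_) (choose k zs) ++ chooseAround zero k zs
        ↭⟨ ++⁺ˡ (map (z ∷_) (choose k zs)) (choose-pivot zero k zs) ⟩
      choose (suc k) (z ∷ zs) ∎
      where open PermutationReasoning
    choose-pivot (suc j) k (z ∷ zs) = begin
      chooseAround (suc j) k (z ∷ zs)
        ≡⟨ concatMap-map _ _ (picks zs) ⟩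
      concatMap (λ (p , y , q) → choose₂ (λ s t → s ++ y ∷ t) (suc j) k (z ∷ p) q) (picks zs)
        ≡⟨ concatMap-cong (λ (p , y , q) → choose₂-suc-∷ (λ s t → s ++ y ∷ t) j k z p q) (picks zs) ⟩
      concatMap (λ (p , y , q) → choose₂ (λ s t → z ∷ s ++ y ∷ t) j k p q
                                 ++ choose₂ (λ s t → s ++ y ∷ t) (suc j) k p q) (picks zs)
        ↭⟨ concatMap-++-↭ _ _ (picks zs) ⟩
      concatMap (λ (p , y , q) → choose₂ (λ s t → z ∷ s ++ y ∷ t) j k p q) (picks zs) ++ chooseAround (suc j) k zs
        ≡⟨ cong (_++ chooseAround (suc j) k zs)
             (≡.trans (concatMap-cong (λ (p , y , q) → ≡.sym (map-choose₂ (z ∷_) (λ s t → s ++ y ∷ t) j k p q)) (picks zs))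
                      (≡.sym (map-concatMap (z ∷_) _ (picks zs)))) ⟩
      map (z ∷_) (chooseAround j k zs) ++ chooseAround (suc j) k zs
        ↭⟨ ++⁺ (map⁺ (z ∷_) (choose-pivot j k zs)) (choose-pivot (suc j) k zs) ⟩
      choose (suc (suc j + k)) (z ∷ zs) ∎
      where open PermutationReasoning

  module _ {A : Set a} {B : Set b} where

    choose-map : ∀ m (φ : A → B) xs → choose m (map φ xs) ≡ map (map φ) (choose m xs)
    choose-map zero    φ xs       = ≡.refl
    choose-map (suc m) φ []       = ≡.refl
    choose-map (suc m) φ (x ∷ xs) = begin
      map (φ x ∷_) (choose m (map φ xs)) ++ choose (suc m) (map φ xs)
        ≡⟨ cong₂ _++_ (cong (map (φ x ∷_)) (choose-map m φ xs)) (choose-map (suc m) φ xs) ⟩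
      map (φ x ∷_) (map (map φ) (choose m xs)) ++ map (map φ) (choose (suc m) xs)
        ≡⟨ cong (_++ _) (≡.trans (≡.sym (map-∘ (choose m xs))) (map-∘ (choose m xs))) ⟩
      map (map φ) (map (x ∷_) (choose m xs)) ++ map (map φ) (choose (suc m) xs)
        ≡⟨ map-++ (map φ) (map (x ∷_) (choose m xs)) _ ⟨
      map (map φ) (choose (suc m) (x ∷ xs)) ∎
      where open ≡.≡-Reasoning

    choose₂-map : {C : Set c} (_⊗_ : List B → List B → C) (φ ψ : A → B) → ∀ m n u v →
      choose₂ _⊗_ m n (map φ u) (map ψ v) ≡ choose₂ (λ s t → map φ s ⊗ map ψ t) m n u v
    choose₂-map _⊗_ φ ψ m n u v = begin
      concatMap (λ s → map (s ⊗_) (choose n (map ψ v))) (choose m (map φ u))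
        ≡⟨ cong₂ (λ cv cu → concatMap (λ s → map (s ⊗_) cv) cu) (choose-map n ψ v) (choose-map m φ u) ⟩
      concatMap (λ s → map (s ⊗_) (map (map ψ) (choose n v))) (map (map φ) (choose m u))
        ≡⟨ concatMap-map _ (map φ) (choose m u) ⟩
      concatMap (λ s → map (map φ s ⊗_) (map (map ψ) (choose n v))) (choose m u)
        ≡⟨ concatMap-cong (λ s → ≡.sym (map-∘ (choose n v))) (choose m u) ⟩
      choose₂ (λ s t → map φ s ⊗ map ψ t) m n u v ∎
      where open ≡.≡-Reasoning

module _ {c ℓ : Level} (G : AbelianGroup c ℓ) where

  open AbelianGroup G renaming (Carrier to A)
  open import Algebra.Properties.CommutativeMonoid.Mult commutativeMonoid
    using (×-homo-+; ×-distrib-+; ×-congʳ) renaming (_×_ to _·_)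
  open import Algebra.Properties.CommutativeSemigroup commutativeSemigroup using (xy∙z≈xz∙y)
  open import Algebra.Properties.Group group using (//-rightDividesˡ; //-rightDividesʳ)
  open import Algebra.Solver.CommutativeMonoid commutativeMonoid using (solve; _⊜_; _⊕_)
  open Combinatorics
  open Permutation setoid using (_↭_; ↭-refl; ↭-sym; ↭-trans; prep; module PermutationReasoning)
  open PermutationProperties setoid using (++⁺)

  private
    fromPropositional : {xs ys : List A} → xs Propositional.↭ ys → xs ↭ ys
    fromPropositional = Propositional.↭⇒↭ₛ′ isEquivalence

  module _ {b} {B : Set b} where

    map-≈-All : {g h : B → A} {zs : List B} →
      All (λ z → g z ≈ h z) zs → map g zs ↭ map h zs
    map-≈-All []       = ↭-refl
    map-≈-All (e ∷ es) = prep e (map-≈-All es)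

    concatMap-↭-All : {g h : B → List A} {zs : List B} →
      All (λ z → g z ↭ h z) zs → concatMap g zs ↭ concatMap h zs
    concatMap-↭-All []       = ↭-refl
    concatMap-↭-All (e ∷ es) = ++⁺ e (concatMap-↭-All es)

    map-≈ : {g h : B → A} → (∀ z → g z ≈ h z) → (zs : List B) → map g zs ↭ map h zs
    map-≈ e zs = map-≈-All (All.universal e zs)

    concatMap-↭ : {g h : B → List A} → (∀ z → g z ↭ h z) → (zs : List B) → concatMap g zs ↭ concatMap h zs
    concatMap-↭ e zs = concatMap-↭-All (All.universal e zs)

  choose₂-≈ : ∀ {g h : List A → List A → A} m n (u v : List A) →
    (∀ s t → length s ≡ m → length t ≡ n → g s t ≈ h s t) → choose₂ g m n u v ↭ choose₂ h m n u v
  choose₂-≈ m n u v e =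
    concatMap-↭-All (All.map (λ {s} ls → map-≈-All (All.map (λ {t} → e s t ls) (choose-length n v)))
                             (choose-length m u))

  times≡× : ∀ n x → times G n x ≡ n · x
  times≡× zero    x = ≡.refl
  times≡× (suc n) x = cong (x ∙_) (times≡× n x)

  times-+ : ∀ m n x → times G (m + n) x ≈ times G m x ∙ times G n x
  times-+ m n x rewrite times≡× (m + n) x | times≡× m x | times≡× n x = ×-homo-+ x m n

  times-∙ : ∀ n x y → times G n (x ∙ y) ≈ times G n x ∙ times G n y
  times-∙ n x y rewrite times≡× n (x ∙ y) | times≡× n x | times≡× n y = ×-distrib-+ x y n

  times-cong : ∀ n {x y} → x ≈ y → times G n x ≈ times G n y
  times-cong n {x} {y} e rewrite times≡× n x | times≡× n y = ×-congʳ n e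

  sum-++ : ∀ u v → sumG G (u ++ v) ≈ sumG G u ∙ sumG G v
  sum-++ []      v = sym (identityˡ _)
  sum-++ (z ∷ u) v = trans (∙-congˡ (sum-++ u v)) (sym (assoc _ _ _))

  sum-map-∙ʳ : ∀ a s → sumG G (map (_∙ a) s) ≈ sumG G s ∙ times G (length s) a
  sum-map-∙ʳ a []      = sym (identityˡ _)
  sum-map-∙ʳ a (z ∷ s) = trans (∙-congˡ (sum-map-∙ʳ a s))
    (solve 4 (λ z a S T → (z ⊕ a) ⊕ (S ⊕ T) ⊜ (z ⊕ S) ⊕ (a ⊕ T)) refl z a (sumG G s) (times G (length s) a))

  -- Turns identities between entries into inverse-free ones, within reach of the
  -- commutative-monoid solver.
  -∙-cross : ∀ {a b c d u v} → (a ∙ c) ∙ v ≈ (b ∙ d) ∙ u → (a - u) ∙ c ≈ (b - v) ∙ d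
  -∙-cross {a} {b} {c} {d} {u} {v} e = begin
    (a - u) ∙ c            ≈⟨ //-rightDividesʳ v _ ⟨
    ((a - u) ∙ c) ∙ v - v  ≈⟨ ∙-congʳ (solve 4 (λ a u' c v → ((a ⊕ u') ⊕ c) ⊕ v ⊜ ((a ⊕ c) ⊕ v) ⊕ u')
                                               refl a (u ⁻¹) c v) ⟩
    ((a ∙ c) ∙ v) - u - v  ≈⟨ ∙-congʳ (∙-congʳ e) ⟩
    ((b ∙ d) ∙ u) - u - v  ≈⟨ ∙-congʳ (//-rightDividesʳ u _) ⟩
    (b ∙ d) - v            ≈⟨ solve 3 (λ b d v' → (b ⊕ d) ⊕ v' ⊜ (b ⊕ v') ⊕ d) refl b d (v ⁻¹) ⟩
    (b - v) ∙ d            ∎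
    where open ≈-Reasoning setoid

  entry : ℕ → A → A → List A → A
  entry r γ x s = ((sumG G s ∙ x) - times G r x) ∙ γ

  fullEntry : ℕ → A → A → List A → A
  fullEntry r γ x t = (sumG G t - times G r x) ∙ γ

  entry-suc : ∀ r γ x t → entry (suc r) γ x t ≈ fullEntry r γ x t
  entry-suc r γ x t = -∙-cross
    (solve 4 (λ S x g X → ((S ⊕ x) ⊕ g) ⊕ X ⊜ (S ⊕ g) ⊕ (x ⊕ X)) refl (sumG G t) x γ (times G r x))

  entry-∷ : ∀ r γ x s → entry r γ x s ≈ fullEntry r γ x (x ∷ s)
  entry-∷ r γ x s = ∙-congʳ (∙-congʳ (comm _ _))

  fPair₁ : ℕ → A → List⁺ A → List A
  fPair₁ r γ w = f₁ G r γ w ++ f₁ G (suc r) γ w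

  fPair : ℕ → A → List (List⁺ A) → List A
  fPair r γ X = f G r γ X ++ f G (suc r) γ X

  map-fullEntry-choose : ∀ r γ x xs → map (fullEntry r γ x) (choose (suc r) (x ∷ xs)) ↭ fPair₁ r γ (x ∷ xs)
  map-fullEntry-choose r γ x xs = begin
    map (fullEntry r γ x) (map (x ∷_) (choose r xs) ++ choose (suc r) xs)
      ≡⟨ ≡.trans (map-++ _ (map (x ∷_) (choose r xs)) _)
                 (cong (_++ map (fullEntry r γ x) (choose (suc r) xs)) (≡.sym (map-∘ (choose r xs)))) ⟩
    map (λ s → fullEntry r γ x (x ∷ s)) (choose r xs) ++ map (fullEntry r γ x) (choose (suc r) xs)
      ↭⟨ ++⁺ (map-≈ (λ s → sym (entry-∷ r γ x s)) (choose r xs))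
             (map-≈ (λ t → sym (entry-suc r γ x t)) (choose (suc r) xs)) ⟩
    fPair₁ r γ (x ∷ xs) ∎
    where open PermutationReasoning

  offset : A → A → A → ℕ × ℕ → A
  offset α β γ (m , n) = (γ ∙ times G m α) ∙ times G n β

  entry-shifted : ∀ {r m n} α β γ x y (s t : List A) → m + n ≡ r → length s ≡ m → length t ≡ n →
    entry r γ y (map (_∙ ((y - x) ∙ α)) s ++ map (_∙ ((y - x) ∙ β)) t)
      ≈ fullEntry r (offset α β γ (m , n)) x (s ++ y ∷ t)
  entry-shifted α β γ x y s t ≡.refl ≡.refl ≡.refl = -∙-cross (begin
    ((sumG G (map (_∙ (d ∙ α)) s ++ map (_∙ (d ∙ β)) t) ∙ y) ∙ γ) ∙ X
      ≈⟨ ∙-congʳ (∙-congʳ (∙-congʳ shifted-sum)) ⟩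
    ((((S ∙ (dm ∙ αm)) ∙ (T ∙ (dn ∙ βn))) ∙ y) ∙ γ) ∙ X
      ≈⟨ solve 9 (λ S T y γ X dm dn αm βn →
           ((((S ⊕ (dm ⊕ αm)) ⊕ (T ⊕ (dn ⊕ βn))) ⊕ y) ⊕ γ) ⊕ X
             ⊜ ((S ⊕ (y ⊕ T)) ⊕ ((γ ⊕ αm) ⊕ βn)) ⊕ ((dm ⊕ dn) ⊕ X))
           refl S T y γ X dm dn αm βn ⟩
    ((S ∙ (y ∙ T)) ∙ offset α β γ (m , n)) ∙ ((dm ∙ dn) ∙ X)
      ≈⟨ ∙-cong (∙-congʳ (sum-++ s (y ∷ t))) times-y ⟨
    (sumG G (s ++ y ∷ t) ∙ offset α β γ (m , n)) ∙ times G (m + n) y ∎)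
    where
    open ≈-Reasoning setoid
    d = y - x
    m = length s
    n = length t
    S = sumG G s
    T = sumG G t
    X = times G (m + n) x
    dm = times G m d
    dn = times G n d
    αm = times G m α
    βn = times G n β

    shifted-sum : sumG G (map (_∙ (d ∙ α)) s ++ map (_∙ (d ∙ β)) t) ≈ (S ∙ (dm ∙ αm)) ∙ (T ∙ (dn ∙ βn))
    shifted-sum = trans (sum-++ (map (_∙ (d ∙ α)) s) (map (_∙ (d ∙ β)) t))
                        (∙-cong (trans (sum-map-∙ʳ _ s) (∙-congˡ (times-∙ m d α)))
                                (trans (sum-map-∙ʳ _ t) (∙-congˡ (times-∙ n d β))))

    times-y : times G (m + n) y ≈ (dm ∙ dn) ∙ X
    times-y = trans (times-cong (m + n) (sym (//-rightDividesˡ x y)))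
                    (trans (times-∙ (m + n) d x) (∙-congʳ (times-+ m n d)))

  f₁-M₁ : ∀ r γ w → f₁ G (suc r) γ (M₁ G w) ↭ fPair₁ r γ w
  f₁-M₁ r γ (x ∷ xs) =
    ↭-trans (map-≈ (entry-suc r γ x) (choose (suc r) (x ∷ xs))) (map-fullEntry-choose r γ x xs)

  pivotEntries : ℕ → A → A → ℕ × ℕ → List A × A × List A → List A
  pivotEntries r c x (m , n) (p , y , q) = map (fullEntry r c x) (choose₂ (λ s t → s ++ y ∷ t) m n p q)

  f₁-shifted : ∀ r α β γ x p y q →
    f₁ G r γ (y ∷ (map (_∙ ((y - x) ∙ α)) p ++ map (_∙ ((y - x) ∙ β)) q))
      ↭ concatMap (λ mn → pivotEntries r (offset α β γ mn) x mn (p , y , q)) (splits r)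
  f₁-shifted r α β γ x p y q = begin
    map (entry r γ y) (choose r (map φ p ++ map ψ q))
      ↭⟨ fromPropositional (PropositionalProperties.map⁺ (entry r γ y) (choose-++ r (map φ p) (map ψ q))) ⟩
    map (entry r γ y) (concatMap (λ (m , n) → choose₂ _++_ m n (map φ p) (map ψ q)) (splits r))
      ≡⟨ ≡.trans (map-concatMap (entry r γ y) _ (splits r)) (concatMap-cong (λ (m , n) →
           ≡.trans (map-choose₂ (entry r γ y) _++_ m n (map φ p) (map ψ q))
                   (choose₂-map (λ s t → entry r γ y (s ++ t)) φ ψ m n p q)) (splits r)) ⟩
    concatMap (λ (m , n) → choose₂ (λ s t → entry r γ y (map φ s ++ map ψ t)) m n p q) (splits r)
      ↭⟨ concatMap-↭-All (All.map (λ {(m , n)} e → choose₂-≈ m n p q (λ s t → entry-shifted α β γ x y s t e))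
                                  (splits-sum r)) ⟩
    concatMap (λ (m , n) → choose₂ (λ s t → fullEntry r (offset α β γ (m , n)) x (s ++ y ∷ t)) m n p q) (splits r)
      ≡⟨ concatMap-cong (λ (m , n) → map-choose₂ (fullEntry r (offset α β γ (m , n)) x) _ m n p q) (splits r) ⟨
    concatMap (λ mn → pivotEntries r (offset α β γ mn) x mn (p , y , q)) (splits r) ∎
    where
    open PermutationReasoning
    φ ψ : A → A
    φ = _∙ ((y - x) ∙ α)
    ψ = _∙ ((y - x) ∙ β)

  concatMap-pivotEntries : ∀ {r} m n c x xs → m + n ≡ r →
    concatMap (pivotEntries r c x (m , n)) (picks (x ∷ xs)) ↭ fPair₁ r c (x ∷ xs)
  concatMap-pivotEntries m n c x xs ≡.refl = begin
    concatMap (pivotEntries (m + n) c x (m , n)) (picks (x ∷ xs))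
      ≡⟨ map-concatMap (fullEntry (m + n) c x) _ (picks (x ∷ xs)) ⟨
    map (fullEntry (m + n) c x) (chooseAround m n (x ∷ xs))
      ↭⟨ fromPropositional (PropositionalProperties.map⁺ _ (choose-pivot m n (x ∷ xs))) ⟩
    map (fullEntry (m + n) c x) (choose (suc (m + n)) (x ∷ xs))
      ↭⟨ map-fullEntry-choose (m + n) c x xs ⟩
    fPair₁ (m + n) c (x ∷ xs) ∎
    where open PermutationReasoning

  f-R₁ : ∀ α β r γ w → f G r γ (R₁ G α β w) ↭ concatMap (λ mn → fPair₁ r (offset α β γ mn) w) (splits r)
  f-R₁ α β r γ (x ∷ xs) = begin
    f G r γ (R₁ G α β (x ∷ xs))
      ≡⟨ concatMap-map _ _ (picks (x ∷ xs)) ⟩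
    concatMap (λ (p , y , q) → f₁ G r γ (y ∷ (map (_∙ ((y - x) ∙ α)) p ++ map (_∙ ((y - x) ∙ β)) q)))
              (picks (x ∷ xs))
      ↭⟨ concatMap-↭ (λ (p , y , q) → f₁-shifted r α β γ x p y q) (picks (x ∷ xs)) ⟩
    concatMap (λ t → concatMap (λ mn → pivotEntries r (offset α β γ mn) x mn t) (splits r)) (picks (x ∷ xs))
      ↭⟨ fromPropositional (concatMap-comm _ (picks (x ∷ xs)) (splits r)) ⟩
    concatMap (λ mn → concatMap (pivotEntries r (offset α β γ mn) x mn) (picks (x ∷ xs))) (splits r)
      ↭⟨ concatMap-↭-All (All.map (λ {(m , n)} → concatMap-pivotEntries m n _ x xs) (splits-sum r)) ⟩
    concatMap (λ mn → fPair₁ r (offset α β γ mn) (x ∷ xs)) (splits r) ∎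
    where open PermutationReasoning

  concatMap-fPair₁ : ∀ r γ X → concatMap (fPair₁ r γ) X ↭ fPair r γ X
  concatMap-fPair₁ r γ X = fromPropositional (concatMap-++-↭ (f₁ G r γ) (f₁ G (suc r) γ) X)

  f-M-zero : ∀ γ X → f G 0 γ (M G X) ≡ f G 0 γ X
  f-M-zero γ X = ≡.trans (concatMap-map (f₁ G 0 γ) (M₁ G) X) (concatMap-cong (λ { (x ∷ xs) → ≡.refl }) X)

  f-M-suc : ∀ r γ X → f G (suc r) γ (M G X) ↭ fPair r γ X
  f-M-suc r γ X = begin
    f G (suc r) γ (M G X)                                   ≡⟨ concatMap-map (f₁ G (suc r) γ) (M₁ G) X ⟩
    concatMap (λ w → f₁ G (suc r) γ (M₁ G w)) X             ↭⟨ concatMap-↭ (f₁-M₁ r γ) X ⟩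
    concatMap (fPair₁ r γ) X                                ↭⟨ concatMap-fPair₁ r γ X ⟩
    fPair r γ X                                             ∎
    where open PermutationReasoning

  RExpansion : A → A → ℕ → A → List (List⁺ A) → List A
  RExpansion α β r γ X = concatMap (λ mn → fPair r (offset α β γ mn) X) (splits r)

  f-R : ∀ α β r γ X → f G r γ (R G α β X) ↭ RExpansion α β r γ X
  f-R α β r γ X = begin
    f G r γ (R G α β X)
      ≡⟨ concatMap-concatMap (f₁ G r γ) (R₁ G α β) X ⟩
    concatMap (λ w → f G r γ (R₁ G α β w)) X
      ↭⟨ concatMap-↭ (f-R₁ α β r γ) X ⟩
    concatMap (λ w → concatMap (λ mn → fPair₁ r (offset α β γ mn) w) (splits r)) X
      ↭⟨ fromPropositional (concatMap-comm (λ w mn → fPair₁ r (offset α β γ mn) w) X (splits r)) ⟩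
    concatMap (λ mn → concatMap (fPair₁ r (offset α β γ mn)) X) (splits r)
      ↭⟨ concatMap-↭ (λ mn → concatMap-fPair₁ r (offset α β γ mn) X) (splits r) ⟩
    RExpansion α β r γ X ∎
    where open PermutationReasoning

  f-cong : ∀ r {γ γ′} → γ ≈ γ′ → ∀ X → f G r γ X ↭ f G r γ′ X
  f-cong r e X = concatMap-↭ (λ { (x ∷ xs) → map-≈ (λ s → ∙-congˡ e) (choose r xs) }) X

  RExpansion-comm : ∀ α β r γ X → RExpansion α β r γ X ↭ RExpansion β α r γ X
  RExpansion-comm α β r γ X = begin
    concatMap (λ mn → fPair r (offset α β γ mn) X) (splits r)
      ↭⟨ concatMap-↭ (λ mn → ++⁺ (f-cong r (offset-comm mn) X) (f-cong (suc r) (offset-comm mn) X)) (splits r) ⟩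
    concatMap (λ mn → fPair r (offset β α γ (swap mn)) X) (splits r)
      ≡⟨ concatMap-map (λ mn → fPair r (offset β α γ mn) X) swap (splits r) ⟨
    concatMap (λ mn → fPair r (offset β α γ mn) X) (map swap (splits r))
      ↭⟨ fromPropositional (concatMap⁺ (λ mn → fPair r (offset β α γ mn) X) (map-swap-splits r)) ⟩
    RExpansion β α r γ X ∎
    where
    open PermutationReasoning
    offset-comm : ∀ mn → offset α β γ mn ≈ offset β α γ (swap mn)
    offset-comm (m , n) = xy∙z≈xz∙y γ (times G m α) (times G n β)

  module _ (X Y : List (List⁺ A)) (f-X↭f-Y : ∀ r γ → f G r γ X ↭ f G r γ Y) where

    fPair-cong : ∀ r γ → fPair r γ X ↭ fPair r γ Y
    fPair-cong r γ = ++⁺ (f-X↭f-Y r γ) (f-X↭f-Y (suc r) γ)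

    RExpansion-cong : ∀ α β r γ → RExpansion α β r γ X ↭ RExpansion α β r γ Y
    RExpansion-cong α β r γ = concatMap-↭ (λ mn → fPair-cong r (offset α β γ mn)) (splits r)

    f-M-cong : ∀ r γ → f G r γ (M G X) ↭ f G r γ (M G Y)
    f-M-cong zero    γ rewrite f-M-zero γ X | f-M-zero γ Y = f-X↭f-Y 0 γ
    f-M-cong (suc r) γ = ↭-trans (f-M-suc r γ X) (↭-trans (fPair-cong r γ) (↭-sym (f-M-suc r γ Y)))

lemma2p3 : {c ℓ : Level} (G : AbelianGroup c ℓ) (α β : AbelianGroup.Carrier G)
    (X Y : List (List⁺ (AbelianGroup.Carrier G))) →
    ((r : ℕ) (γ : AbelianGroup.Carrier G) → _≋_ G (f G r γ X) (f G r γ Y)) →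
    (r : ℕ) (γ : AbelianGroup.Carrier G) →
      _≋_ G (f G r γ (M G X)) (f G r γ (M G Y))
      × _≋_ G (f G r γ (R G α β X)) (f G r γ (R G α β Y))
      × _≋_ G (f G r γ (R G α β X)) (f G r γ (R G β α Y))
lemma2p3 G α β X Y f-X↭f-Y r γ = f-M-cong G X Y f-X↭f-Y r γ , R-same , R-swapped
  where
  open Permutation (AbelianGroup.setoid G) using (module PermutationReasoning)
  open PermutationReasoning

  R-same : _≋_ G (f G r γ (R G α β X)) (f G r γ (R G α β Y))
  R-same = begin
    f G r γ (R G α β X)     ↭⟨ f-R G α β r γ X ⟩
    RExpansion G α β r γ X  ↭⟨ RExpansion-cong G X Y f-X↭f-Y α β r γ ⟩
    RExpansion G α β r γ Y  ↭⟨ f-R G α β r γ Y ⟨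
    f G r γ (R G α β Y)     ∎

  R-swapped : _≋_ G (f G r γ (R G α β X)) (f G r γ (R G β α Y))
  R-swapped = begin
    f G r γ (R G α β X)     ↭⟨ f-R G α β r γ X ⟩
    RExpansion G α β r γ X  ↭⟨ RExpansion-cong G X Y f-X↭f-Y α β r γ ⟩
    RExpansion G α β r γ Y  ↭⟨ RExpansion-comm G α β r γ Y ⟩
    RExpansion G β α r γ Y  ↭⟨ f-R G β α r γ Y ⟨
    f G r γ (R G β α Y)     ∎
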